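{- $H_s(6,2)<6$.
   Context: A simplicial complex on $n$ vertices is a family $\mathcal F$ of subsets of $[n]$ closed under taking subsets; it is a simplicial $d$-complex if the maximum size of a set in $\mathcal F$ is $d+1$. The dual graph of a simplicial $d$-complex has as vertices its sets of size $d+1$, two being adjacent if their intersection has size $d$; the diameter of the complex is the diameter of its dual graph. $H_s(n,d)$ is the maximum diameter of a simplicial $d$-complex on $n$ vertices with connected dual graph. -}

module Defs where

open import Data.Nat using (ℕ; zero; suc; _≤_; _<_)
open import Data.Bool using (Bool; true)
open import Data.Product using (Σ; ∃; _×_; _,_)
open import Data.Fin.Subset using (Subset; _⊆_; _∩_; ∣_∣)
open import Relation.Binary.PropositionalEquality using (_≡_)

record SimplicialComplex (n d : ℕ) : Set where
  field
    F        : Subset n → Bool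
    closed   : ∀ {s t : Subset n} → s ⊆ t → F t ≡ true → F s ≡ true
    bounded  : ∀ (s : Subset n) → F s ≡ true → ∣ s ∣ ≤ suc d
    attained : Σ (Subset n) (λ s → F s ≡ true × ∣ s ∣ ≡ suc d)

open SimplicialComplex public

module _ {n d : ℕ} (K : SimplicialComplex n d) where

  DualVertex : Subset n → Set
  DualVertex s = F K s ≡ true × ∣ s ∣ ≡ suc d

  DualAdj : Subset n → Subset n → Set
  DualAdj s t = ∣ s ∩ t ∣ ≡ d

  data DualWalk : Subset n → Subset n → ℕ → Set where
    here : ∀ {s} → DualVertex s → DualWalk s s 0
    step : ∀ {s t u k} → DualVertex s → DualAdj s t →
           DualWalk t u k → DualWalk s u (suc k)

  DualConnected : Set
  DualConnected = ∀ s t → DualVertex s → DualVertex t →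
                  Σ ℕ (λ k → DualWalk s t k)

  DiameterLt : ℕ → Set
  DiameterLt m = ∀ s t → DualVertex s → DualVertex t →
                 Σ ℕ (λ k → k < m × DualWalk s t k)

{-# OPTIONS --safe #-}
-- The dual graph of a 2-complex on 6 vertices is an induced subgraph of the
-- Johnson graph J(6,3) of 3-subsets of [6], so a shortest walk in it is an
-- induced path of J(6,3). An exhaustive search shows that J(6,3) has no induced
-- path with 6 edges; hence any walk of length ≥ 6 in the dual graph has a
-- shortcut, and every two dual vertices are at distance < 6.
module Submission where

open import Defs
open import Data.Nat using (ℕ; zero; suc; _+_; _≤_; _<_; s≤s; _<?_)
import Data.Nat as ℕ
open import Data.Nat.Induction using (<-wellFounded)
open import Data.Nat.Properties using (+-suc; n<1+n; m<n⇒m<1+n; +-monoˡ-<; ≮⇒≥)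
open import Data.Bool using (true; false)
import Data.Bool as Bool
open import Data.Empty using (⊥)
open import Data.Product using (Σ; _×_; _,_)
open import Data.Sum using (_⊎_; inj₁; inj₂)
open import Data.List using (List; []; _∷_; [_]; map; _++_)
open import Data.List.Membership.Propositional using (_∈_)
open import Data.List.Membership.Propositional.Properties using (∈-map⁺; ∈-++⁺ˡ; ∈-++⁺ʳ)
open import Data.List.Relation.Unary.Any using (Any; here; any?)
open import Data.List.Relation.Unary.All as All using (All; []; _∷_; all?)
open import Data.Vec using ([]; _∷_)
open import Data.Vec.Properties using (≡-dec)
open import Data.Fin.Subset using (Subset; _∩_; ∣_∣)
open import Function using (id)
open import Induction.WellFounded using (Acc; acc)
open import Relation.Nullary using (Dec; does; _because_; yes; no; _⊎-dec_; _→-dec_)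
open import Relation.Nullary.Reflects using (invert)
open import Relation.Binary.PropositionalEquality using (_≡_; refl; sym; subst)

from-does : ∀ {A : Set} (a? : Dec A) → does a? ≡ true → A
from-does (true because [a]) _ = invert [a]

subsetsOfSize : ∀ n → ℕ → List (Subset n)
subsetsOfSize zero    zero    = [ [] ]
subsetsOfSize zero    (suc k) = []
subsetsOfSize (suc n) zero    = map (false ∷_) (subsetsOfSize n zero)
subsetsOfSize (suc n) (suc k) =
  map (true ∷_) (subsetsOfSize n k) ++ map (false ∷_) (subsetsOfSize n (suc k))

∈-subsetsOfSize : ∀ {n} (s : Subset n) → s ∈ subsetsOfSize n ∣ s ∣
∈-subsetsOfSize []          = here refl
∈-subsetsOfSize (true ∷ s)  = ∈-++⁺ˡ (∈-map⁺ (true ∷_) (∈-subsetsOfSize s))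
∈-subsetsOfSize (false ∷ s) with ∣ s ∣ | ∈-subsetsOfSize s
... | zero  | s∈ = ∈-map⁺ (false ∷_) s∈
... | suc k | s∈ = ∈-++⁺ʳ _ (∈-map⁺ (false ∷_) s∈)

module _ {n : ℕ} (d : ℕ) where

  Near : Subset n → List (Subset n) → Set
  Near v = Any (λ u → u ≡ v ⊎ ∣ u ∩ v ∣ ≡ d)

  -- Paths of the Johnson graph J(n, d+1) are recorded as their last vertex y
  -- and the list ps of the earlier ones, most recent first:
  -- InducedExtensions< b y ps says that every induced path extending it has
  -- fewer than b further edges.
  InducedExtensions< : ℕ → Subset n → List (Subset n) → Set
  InducedExtensions< zero    y ps = ⊥
  InducedExtensions< (suc b) y ps = All
    (λ v → ∣ y ∩ v ∣ ≡ d → Near v ps ⊎ InducedExtensions< b v (y ∷ ps))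
    (subsetsOfSize n (suc d))

  near? : ∀ v ps → Dec (Near v ps)
  near? v = any? λ u → ≡-dec Bool._≟_ u v ⊎-dec (∣ u ∩ v ∣ ℕ.≟ d)

  inducedExtensions<? : ∀ b y ps → Dec (InducedExtensions< b y ps)
  inducedExtensions<? zero    y ps = no id
  inducedExtensions<? (suc b) y ps = all? (λ v →
    (∣ y ∩ v ∣ ℕ.≟ d) →-dec (near? v ps ⊎-dec inducedExtensions<? b v (y ∷ ps))) _

InducedPaths< : ℕ → ℕ → ℕ → Set
InducedPaths< n d b = All (λ s → InducedExtensions< d b s []) (subsetsOfSize n (suc d))

inducedPaths<? : ∀ n d b → Dec (InducedPaths< n d b)
inducedPaths<? n d b = all? (λ s → inducedExtensions<? d b s []) _

-- Stated as an equation on `does` because `from-yes` would make the type checker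
-- normalise the decision procedure together with its proofs, which is infeasible.
inducedPaths<-J₆₃-checked : does (inducedPaths<? 6 2 6) ≡ true
inducedPaths<-J₆₃-checked = refl

inducedPaths<-J₆₃ : InducedPaths< 6 2 6
inducedPaths<-J₆₃ = from-does (inducedPaths<? 6 2 6) inducedPaths<-J₆₃-checked

module _ {n d : ℕ} (K : SimplicialComplex n d) where

  walk-source : ∀ {s t k} → DualWalk K s t k → DualVertex K s
  walk-source (here ds)     = ds
  walk-source (step ds _ _) = ds

  dualVertex-∈ : ∀ {v} → DualVertex K v → v ∈ subsetsOfSize n (suc d)
  dualVertex-∈ {v} (_ , size) = subst (λ k → v ∈ subsetsOfSize n k) size (∈-subsetsOfSize v)

  snocʷ : ∀ {s u v k} → DualWalk K s u k → DualAdj K u v → DualVertex K v → DualWalk K s v (suc k)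
  snocʷ (here du)     a dv = step du a (here dv)
  snocʷ (step ds b w) a dv = step ds b (snocʷ w a dv)

  _++ʷ_ : ∀ {s u t i j} → DualWalk K s u i → DualWalk K u t j → DualWalk K s t (i + j)
  here _     ++ʷ w′ = w′
  step ds a w ++ʷ w′ = step ds a (w ++ʷ w′)

  Reach< : Subset n → Subset n → ℕ → Set
  Reach< s t m = Σ ℕ (λ k → k < m × DualWalk K s t k)

  reach<-suc : ∀ {s t m} → Reach< s t m → Reach< s t (suc m)
  reach<-suc (k , k<m , w) = k , m<n⇒m<1+n k<m , w

  reach<-near : ∀ {s u v i} → Reach< s u i → u ≡ v ⊎ DualAdj K u v → DualVertex K v →
                Reach< s v (suc i)
  reach<-near r             (inj₁ refl) _  = reach<-suc r
  reach<-near (k , k<i , w) (inj₂ a)    dv = suc k , s≤s k<i , snocʷ w a dv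

  reach<-++ : ∀ {s u t i m} → Reach< s u i → DualWalk K u t m → Reach< s t (i + m)
  reach<-++ {m = m} (k , k<i , w) w′ = k + m , +-monoˡ-< m k<i , w ++ʷ w′

  -- The prefix s ⋯ y of the walk, of length i, is an induced path whose earlier
  -- vertices ps are reached in fewer than i steps. The next vertex either is near
  -- one of ps, giving a shortcut, or extends the induced path, which by the
  -- hypothesis can happen fewer than b times.
  reach<-shortcut : ∀ b {s y ps i t m} → InducedExtensions< d b y ps →
                    All (λ u → Reach< s u i) ps → DualWalk K s y i →
                    DualWalk K y t m → b ≤ m → Reach< s t (i + m)
  reach<-shortcut (suc b) {s} {i = i} {t} ext reach-ps p (step {t = v} {k = m} _ a w) (s≤s b≤m) =
    subst (Reach< s t) (sym (+-suc i m)) continue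
    where
    dv : DualVertex K v
    dv = walk-source w

    continue : Reach< s t (suc i + m)
    continue with All.lookup ext (dualVertex-∈ dv) a
    ... | inj₁ near = reach<-++ (All.lookupWith (λ r c → reach<-near r c dv) reach-ps near) w
    ... | inj₂ ext′ = reach<-shortcut b ext′ ((i , n<1+n i , p) ∷ All.map reach<-suc reach-ps)
                                      (snocʷ p a dv) w b≤m

  reach<-of-walk : ∀ {b s t m} → InducedPaths< n d b → Acc _<_ m → DualWalk K s t m → Reach< s t b
  reach<-of-walk {b} {m = m} paths (acc shorter) w with m <? b
  ... | yes m<b = m , m<b , w
  ... | no m≮b with reach<-shortcut b (All.lookup paths (dualVertex-∈ (walk-source w)))
                                    [] (here (walk-source w)) w (≮⇒≥ m≮b)
  ...   | k , k<m , w′ = reach<-of-walk paths (shorter k<m) w′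

  diameter<-of-inducedPaths< : ∀ {b} → InducedPaths< n d b → DualConnected K → DiameterLt K b
  diameter<-of-inducedPaths< paths connected s t ds dt =
    let m , w = connected s t ds dt in reach<-of-walk paths (<-wellFounded m) w

lemmaB1 : (K : SimplicialComplex 6 2) → DualConnected K → DiameterLt K 6
lemmaB1 K = diameter<-of-inducedPaths< K inducedPaths<-J₆₃
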